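{- The following contraction rules are height-preserving admissible in $G^{+}_{Grz}$: c-l: from $\Box\Sigma|\Gamma,\alpha,\alpha\Rightarrow\Delta$ infer $\Box\Sigma|\Gamma,\alpha\Rightarrow\Delta$; c-r: from $\Box\Sigma|\Gamma\Rightarrow\Delta,\alpha,\alpha$ infer $\Box\Sigma|\Gamma\Rightarrow\Delta,\alpha$; c-l$^+$: from $\Box\Sigma,\Box\alpha,\Box\alpha|\Gamma\Rightarrow\Delta$ infer $\Box\Sigma,\Box\alpha|\Gamma\Rightarrow\Delta$.
   Context: Formulas are built from propositional variables and $\bot$ by $\neg,\wedge,\vee,\Box$; $\alpha\to\beta:=\neg\alpha\vee\beta$; $\Box\Gamma$ is the multiset $\Gamma$ with each element prefixed by $\Box$; $D(\alpha):=\Box(\alpha\to\Box\alpha)$. Sequents of $G^{+}_{Grz}$ have the form $\Box\Sigma|\Gamma\Rightarrow\Delta$ with $\Sigma,\Gamma,\Delta$ finite multisets of formulas. Axioms: $\Box\Sigma|\Gamma,p\Rightarrow p,\Delta$ ($p$ a propositional variable) and $\Box\Sigma|\Gamma,\bot\Rightarrow\Delta$. Propositional rules (with $\Box\Sigma$ unchanged): $\wedge$-l from $\Box\Sigma|\Gamma,\alpha,\beta\Rightarrow\Delta$ to $\Box\Sigma|\Gamma,\alpha\wedge\beta\Rightarrow\Delta$; $\vee$-r from $\Box\Sigma|\Gamma\Rightarrow\alpha,\beta,\Delta$ to $\Box\Sigma|\Gamma\Rightarrow\alpha\vee\beta,\Delta$; $\neg$-r from $\Box\Sigma|\Gamma,\alpha\Rightarrow\Delta$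 to $\Box\Sigma|\Gamma\Rightarrow\neg\alpha,\Delta$; $\neg$-l from $\Box\Sigma|\Gamma\Rightarrow\alpha,\Delta$ to $\Box\Sigma|\Gamma,\neg\alpha\Rightarrow\Delta$; $\wedge$-r from $\Box\Sigma|\Gamma\Rightarrow\alpha,\Delta$ and $\Box\Sigma|\Gamma\Rightarrow\beta,\Delta$ to $\Box\Sigma|\Gamma\Rightarrow\alpha\wedge\beta,\Delta$; $\vee$-l from $\Box\Sigma|\Gamma,\alpha\Rightarrow\Delta$ and $\Box\Sigma|\Gamma,\beta\Rightarrow\Delta$ to $\Box\Sigma|\Gamma,\alpha\vee\beta\Rightarrow\Delta$. Modal rules: $\Box^{+}_{T}$: from $\Box\alpha,\Box\Sigma|\Gamma,\alpha\Rightarrow\Delta$ infer $\Box\Sigma|\Gamma,\Box\alpha\Rightarrow\Delta$; $\Box^{+}_{Grz1}$: from $\Box\Gamma|\emptyset\Rightarrow\alpha$ infer $\Box\Gamma|\Pi\Rightarrow\Box\alpha,\Delta$ provided $D(\alpha)\in\Box\Gamma$; $\Box^{+}_{Grz2}$: from $\Box\Gamma,D(\alpha)|\Gamma\Rightarrow\alpha$ infer $\Box\Gamma|\Pi\Rightarrow\Box\alpha,\Delta$ provided $D(\alpha)\notin\Box\Gamma$; in both, $\Pi$ contains only propositional variables and $\Delta$ only propositional variables and boxed formulas. A rule is height-preserving admissible if whenever its premise has a proof, its conclusion has a proof of at most the same height. -}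

module Defs where

open import Data.Nat using (ℕ; suc; _⊔_; _≤_)
open import Data.List using (List; []; _∷_; map)
open import Data.List.Relation.Unary.All using (All)
open import Data.List.Membership.Propositional using (_∈_)
open import Data.List.Relation.Binary.Permutation.Propositional using (_↭_)
open import Data.Product using (Σ-syntax; _×_)
open import Data.Sum using (_⊎_)
open import Relation.Nullary using (¬_)
open import Relation.Binary.PropositionalEquality using (_≡_)

data Fm : Set where
  var  : ℕ → Fm
  ⊥'   : Fm
  ¬'_  : Fm → Fm
  _∧'_ : Fm → Fm → Fm
  _∨'_ : Fm → Fm → Fm
  □_   : Fm → Fm

infixr 30 _∧'_
infixr 25 _∨'_
infixr 20 _→'_
infix  40 ¬'_ □_

_→'_ : Fm → Fm → Fm
a →' b = ¬' a ∨' b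

D : Fm → Fm
D a = □ (a →' □ a)

IsVar : Fm → Set
IsVar f = Σ[ n ∈ ℕ ] f ≡ var n

IsBox : Fm → Set
IsBox f = Σ[ g ∈ Fm ] f ≡ □ g

-- A sequent □Σ | Γ ⇒ Δ.  The field 'boxed' stores the multiset Σ
-- (so the boxed part of the sequent is □Σ = map □_ boxed).
-- Multisets are lists considered up to permutation (_↭_).
record Seq : Set where
  constructor _∣_⇒_
  field
    boxed : List Fm
    ante  : List Fm
    succ  : List Fm

infix 4 _∣_⇒_
infix 2 _≈S_

_≈S_ : Seq → Seq → Set
(s₁ ∣ g₁ ⇒ d₁) ≈S (s₂ ∣ g₂ ⇒ d₂) = (s₁ ↭ s₂) × (g₁ ↭ g₂) × (d₁ ↭ d₂)

-- Derivations in G⁺_Grz.  Every rule's conclusion is any sequent equal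
-- (as multisets) to the displayed one, so sequents really are multisets.
data Proof : Seq → Set where
  ax  : ∀ {S} Σ Γ Δ n → S ≈S (Σ ∣ var n ∷ Γ ⇒ var n ∷ Δ) → Proof S
  ax⊥ : ∀ {S} Σ Γ Δ → S ≈S (Σ ∣ ⊥' ∷ Γ ⇒ Δ) → Proof S
  ∧l  : ∀ {S} Σ Γ Δ a b → S ≈S (Σ ∣ (a ∧' b) ∷ Γ ⇒ Δ) →
        Proof (Σ ∣ a ∷ b ∷ Γ ⇒ Δ) → Proof S
  ∨r  : ∀ {S} Σ Γ Δ a b → S ≈S (Σ ∣ Γ ⇒ (a ∨' b) ∷ Δ) →
        Proof (Σ ∣ Γ ⇒ a ∷ b ∷ Δ) → Proof S
  ¬r  : ∀ {S} Σ Γ Δ a → S ≈S (Σ ∣ Γ ⇒ (¬' a) ∷ Δ) →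
        Proof (Σ ∣ a ∷ Γ ⇒ Δ) → Proof S
  ¬l  : ∀ {S} Σ Γ Δ a → S ≈S (Σ ∣ (¬' a) ∷ Γ ⇒ Δ) →
        Proof (Σ ∣ Γ ⇒ a ∷ Δ) → Proof S
  ∧r  : ∀ {S} Σ Γ Δ a b → S ≈S (Σ ∣ Γ ⇒ (a ∧' b) ∷ Δ) →
        Proof (Σ ∣ Γ ⇒ a ∷ Δ) → Proof (Σ ∣ Γ ⇒ b ∷ Δ) → Proof S
  ∨l  : ∀ {S} Σ Γ Δ a b → S ≈S (Σ ∣ (a ∨' b) ∷ Γ ⇒ Δ) →
        Proof (Σ ∣ a ∷ Γ ⇒ Δ) → Proof (Σ ∣ b ∷ Γ ⇒ Δ) → Proof S
  -- □⁺_T : from □α,□Σ | Γ,α ⇒ Δ infer □Σ | Γ,□α ⇒ Δ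
  □T  : ∀ {S} Σ Γ Δ a → S ≈S (Σ ∣ (□ a) ∷ Γ ⇒ Δ) →
        Proof (a ∷ Σ ∣ a ∷ Γ ⇒ Δ) → Proof S
  -- □⁺_Grz1 : from □Γ | ∅ ⇒ α infer □Γ | Π ⇒ □α,Δ, provided D(α) ∈ □Γ
  grz1 : ∀ {S} Γ Π Δ a → S ≈S (Γ ∣ Π ⇒ (□ a) ∷ Δ) →
         All IsVar Π → All (λ f → IsVar f ⊎ IsBox f) Δ →
         (a →' □ a) ∈ Γ →
         Proof (Γ ∣ [] ⇒ a ∷ []) → Proof S
  -- □⁺_Grz2 : from □Γ,D(α) | Γ ⇒ α infer □Γ | Π ⇒ □α,Δ, provided D(α) ∉ □Γ
  grz2 : ∀ {S} Γ Π Δ a → S ≈S (Γ ∣ Π ⇒ (□ a) ∷ Δ) →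
         All IsVar Π → All (λ f → IsVar f ⊎ IsBox f) Δ →
         ¬ ((a →' □ a) ∈ Γ) →
         Proof ((a →' □ a) ∷ Γ ∣ Γ ⇒ a ∷ []) → Proof S

height : ∀ {S} → Proof S → ℕ
height (ax _ _ _ _ _) = 1
height (ax⊥ _ _ _ _) = 1
height (∧l _ _ _ _ _ _ p) = suc (height p)
height (∨r _ _ _ _ _ _ p) = suc (height p)
height (¬r _ _ _ _ _ p) = suc (height p)
height (¬l _ _ _ _ _ p) = suc (height p)
height (∧r _ _ _ _ _ _ p q) = suc (height p ⊔ height q)
height (∨l _ _ _ _ _ _ p q) = suc (height p ⊔ height q)
height (□T _ _ _ _ _ p) = suc (height p)
height (grz1 _ _ _ _ _ _ _ _ p) = suc (height p)
height (grz2 _ _ _ _ _ _ _ _ p) = suc (height p)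

HPAdmissible : Seq → Seq → Set
HPAdmissible P C = (d : Proof P) → Σ[ d' ∈ Proof C ] height d' ≤ height d

-- Each contraction is the rule "from S ⊕ C infer T ⊕ C" for fixed sequent pieces S, T and an
-- arbitrary context C, and is proved admissible for derivations of height ≤ k by induction on
-- k.  A last rule acting inside C commutes with it.  A Grz conclusion has only variables in its
-- antecedent and only variables and boxes in its succedent, so it never contains a formula where
-- another rule would introduce it; hence every rule is invertible with the same height.  To
-- contract α, invert the rule introducing one copy of α in each premise of the rule introducing
-- the other: every formula of that premise then occurs twice at a smaller height, and the
-- induction hypothesis contracts it.  The three contractions must go together because the
-- premise of □⁺_T puts α both into the boxed part and the antecedent, and the premise of
-- □⁺_Grz2 contains Γ in both.
module Submission where

open import Defs
open import Algebra.Bundles using (CommutativeMonoid)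
open import Algebra.Structures using (IsCommutativeMonoid)
open import Data.Empty using (⊥-elim)
open import Relation.Nullary using (¬_)
open import Data.List using (List; []; _∷_; _++_; replicate)
open import Data.List.Membership.Propositional using (_∈_)
open import Data.List.Membership.Propositional.Properties using (∈-∃++; ∈-++⁻; ∈-++⁺ˡ; ∈-++⁺ʳ)
open import Data.List.Relation.Binary.Permutation.Propositional using (_↭_; ↭-refl; ↭-sym; ↭-trans; ↭-prep)
open import Data.List.Relation.Binary.Permutation.Propositional.Properties
  using (∈-resp-↭; All-resp-↭; shift; drop-∷; ¬x∷xs↭[]; ++⁺ˡ; ++⁺ʳ; ++-isCommutativeMonoid)
open import Data.List.Relation.Unary.All as All using (All; []; _∷_)
open import Data.List.Relation.Unary.All.Properties using (replicate⁺)
open import Data.List.Relation.Unary.Any using (here; there)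
open import Data.Nat using (ℕ; zero; suc; _≤_; s≤s; z≤n; s≤s⁻¹)
open import Data.Nat.Properties
  using (≤-refl; ≤-reflexive; ≤-trans; n≤1+n; ⊔-lub; m⊔n≤o⇒m≤o; m⊔n≤o⇒n≤o)
open import Data.Product using (Σ-syntax; ∃-syntax; _×_; _,_; proj₁; proj₂)
open import Data.Sum using (_⊎_; inj₁; inj₂)
open import Function using (_∘_)
open import Relation.Binary.PropositionalEquality using (_≡_; refl)

private
  variable
    k : ℕ
    f g a α : Fm
    xs ys zs : List Fm
    S T C : Seq

-- Sequents as a commutative monoid under multiset union

infixr 6 _⊕_

_⊕_ : Seq → Seq → Seq
(b₁ ∣ g₁ ⇒ d₁) ⊕ (b₂ ∣ g₂ ⇒ d₂) = b₁ ++ b₂ ∣ g₁ ++ g₂ ⇒ d₁ ++ d₂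

ε : Seq
ε = [] ∣ [] ⇒ []

⊕-isCommutativeMonoid : IsCommutativeMonoid _≈S_ _⊕_ ε
⊕-isCommutativeMonoid = record
  { isMonoid = record
    { isSemigroup = record
      { isMagma = record
        { isEquivalence = record
          { refl  = ↭-refl , ↭-refl , ↭-refl
          ; sym   = λ (b , g , d) → ↭-sym b , ↭-sym g , ↭-sym d
          ; trans = λ (b , g , d) (b′ , g′ , d′) → ↭-trans b b′ , ↭-trans g g′ , ↭-trans d d′
          }
        ; ∙-cong = λ (b , g , d) (b′ , g′ , d′) → L.∙-cong b b′ , L.∙-cong g g′ , L.∙-cong d d′
        }
      ; assoc = λ (b₁ ∣ g₁ ⇒ d₁) (b₂ ∣ g₂ ⇒ d₂) (b₃ ∣ g₃ ⇒ d₃) →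
                  L.assoc b₁ b₂ b₃ , L.assoc g₁ g₂ g₃ , L.assoc d₁ d₂ d₃
      }
    ; identity = (λ _ → ↭-refl , ↭-refl , ↭-refl)
               , λ (b ∣ g ⇒ d) → L.identityʳ b , L.identityʳ g , L.identityʳ d
    }
  ; comm = λ (b₁ ∣ g₁ ⇒ d₁) (b₂ ∣ g₂ ⇒ d₂) → L.comm b₁ b₂ , L.comm g₁ g₂ , L.comm d₁ d₂
  }
  where module L = IsCommutativeMonoid (++-isCommutativeMonoid {A = Fm})

⊕-commutativeMonoid : CommutativeMonoid _ _
⊕-commutativeMonoid = record { isCommutativeMonoid = ⊕-isCommutativeMonoid }

open CommutativeMonoid ⊕-commutativeMonoid
  using () renaming (refl to ≈S-refl; sym to ≈S-sym; trans to ≈S-trans; ∙-cong to ⊕-cong; assoc to ⊕-assoc)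
open import Algebra.Solver.CommutativeMonoid ⊕-commutativeMonoid
  using (solve; _⊜_) renaming (_⊕_ to _⊕′_)

⊕-congˡ : ∀ X {Y Z} → Y ≈S Z → X ⊕ Y ≈S X ⊕ Z
⊕-congˡ X = ⊕-cong (≈S-refl {X})

⊕-congʳ : ∀ Z {X Y} → X ≈S Y → X ⊕ Z ≈S Y ⊕ Z
⊕-congʳ Z e = ⊕-cong e (≈S-refl {Z})

⊕-swap : ∀ X Y Z → X ⊕ (Y ⊕ Z) ≈S Y ⊕ (X ⊕ Z)
⊕-swap = solve 3 (λ x y z → x ⊕′ (y ⊕′ z) ⊜ y ⊕′ (x ⊕′ z)) ≈S-refl

infix 8 _at_ [_]at_

data Place : Set where
  boxed ante succ : Place

_at_ : List Fm → Place → Seq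
xs at boxed = xs ∣ [] ⇒ []
xs at ante  = [] ∣ xs ⇒ []
xs at succ  = [] ∣ [] ⇒ xs

[_]at_ : Fm → Place → Seq
[ f ]at p = (f ∷ []) at p

[]-at : ∀ p → [] at p ≈S ε
[]-at boxed = ≈S-refl
[]-at ante  = ≈S-refl
[]-at succ  = ≈S-refl

pair-at : ∀ p → (α ∷ α ∷ []) at p ≈S [ α ]at p ⊕ [ α ]at p
pair-at boxed = ≈S-refl
pair-at ante  = ≈S-refl
pair-at succ  = ≈S-refl

∈⇒↭∷ : f ∈ xs → ∃[ ys ] xs ↭ f ∷ ys
∈⇒↭∷ {f} f∈ with ys , zs , refl ← ∈-∃++ f∈ = ys ++ zs , shift f ys zs

∈-dedup : f ∈ α ∷ α ∷ xs → f ∈ α ∷ xs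
∈-dedup (here f≡α) = here f≡α
∈-dedup (there f∈) = f∈

∈-++-monoˡ : ∀ xs → (f ∈ xs → f ∈ ys) → f ∈ xs ++ zs → f ∈ ys ++ zs
∈-++-monoˡ {ys = ys} xs sub f∈ with ∈-++⁻ xs f∈
... | inj₁ f∈xs = ∈-++⁺ˡ (sub f∈xs)
... | inj₂ f∈zs = ∈-++⁺ʳ ys f∈zs

replicate-↭-inv : ∀ n → replicate (suc n) α ↭ g ∷ ys → g ≡ α × ys ↭ replicate n α
replicate-↭-inv {α = α} n e
  with refl ← All.lookup (replicate⁺ {P = _≡ α} (suc n) refl) (∈-resp-↭ (↭-sym e) (here refl)) =
  refl , ↭-sym (drop-∷ e)

↭-∷-++-split : ∀ xs ys → xs ++ ys ↭ f ∷ zs →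
  (∃[ xs′ ] xs ↭ f ∷ xs′ × zs ↭ xs′ ++ ys) ⊎ (∃[ ys′ ] ys ↭ f ∷ ys′ × zs ↭ xs ++ ys′)
↭-∷-++-split {f} xs ys e with ∈-++⁻ xs (∈-resp-↭ (↭-sym e) (here refl))
... | inj₁ f∈xs with xs′ , xs↭ ← ∈⇒↭∷ f∈xs =
  inj₁ (xs′ , xs↭ , drop-∷ (↭-trans (↭-sym e) (++⁺ʳ ys xs↭)))
... | inj₂ f∈ys with ys′ , ys↭ ← ∈⇒↭∷ f∈ys =
  inj₂ (ys′ , ys↭ , drop-∷ (↭-trans (↭-sym e) (↭-trans (++⁺ˡ xs ys↭) (shift f xs ys′))))

at-replicate-inv : ∀ {p q rest} n → replicate (suc n) α at p ≈S [ g ]at q ⊕ rest →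
                   q ≡ p × g ≡ α × (rest ≈S replicate n α at p)
at-replicate-inv {p = boxed} {boxed} n (eb , eg , ed) with refl , e ← replicate-↭-inv n eb =
  refl , refl , e , ↭-sym eg , ↭-sym ed
at-replicate-inv {p = ante} {ante} n (eb , eg , ed) with refl , e ← replicate-↭-inv n eg =
  refl , refl , ↭-sym eb , e , ↭-sym ed
at-replicate-inv {p = succ} {succ} n (eb , eg , ed) with refl , e ← replicate-↭-inv n ed =
  refl , refl , ↭-sym eb , ↭-sym eg , e
at-replicate-inv {p = boxed} {ante} n (_ , e , _) = ⊥-elim (¬x∷xs↭[] (↭-sym e))
at-replicate-inv {p = boxed} {succ} n (_ , _ , e) = ⊥-elim (¬x∷xs↭[] (↭-sym e))
at-replicate-inv {p = ante} {boxed} n (e , _ , _) = ⊥-elim (¬x∷xs↭[] (↭-sym e))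
at-replicate-inv {p = ante} {succ} n (_ , _ , e) = ⊥-elim (¬x∷xs↭[] (↭-sym e))
at-replicate-inv {p = succ} {boxed} n (e , _ , _) = ⊥-elim (¬x∷xs↭[] (↭-sym e))
at-replicate-inv {p = succ} {ante} n (_ , e , _) = ⊥-elim (¬x∷xs↭[] (↭-sym e))

locate : ∀ {p C₁} → S ⊕ C ≈S [ f ]at p ⊕ C₁ →
         (∃[ rest ] (S ≈S [ f ]at p ⊕ rest) × (C₁ ≈S rest ⊕ C))
       ⊎ (∃[ C₂ ] (C ≈S [ f ]at p ⊕ C₂) × (C₁ ≈S S ⊕ C₂))
locate {S = sb ∣ sg ⇒ sd} {C = cb ∣ cg ⇒ cd} {p = boxed} (eb , eg , ed) with ↭-∷-++-split sb cb eb
... | inj₁ (sb′ , es , e₁) = inj₁ ((sb′ ∣ sg ⇒ sd) , (es , ↭-refl , ↭-refl) , (e₁ , ↭-sym eg , ↭-sym ed))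
... | inj₂ (cb′ , ec , e₁) = inj₂ ((cb′ ∣ cg ⇒ cd) , (ec , ↭-refl , ↭-refl) , (e₁ , ↭-sym eg , ↭-sym ed))
locate {S = sb ∣ sg ⇒ sd} {C = cb ∣ cg ⇒ cd} {p = ante} (eb , eg , ed) with ↭-∷-++-split sg cg eg
... | inj₁ (sg′ , es , e₁) = inj₁ ((sb ∣ sg′ ⇒ sd) , (↭-refl , es , ↭-refl) , (↭-sym eb , e₁ , ↭-sym ed))
... | inj₂ (cg′ , ec , e₁) = inj₂ ((cb ∣ cg′ ⇒ cd) , (↭-refl , ec , ↭-refl) , (↭-sym eb , e₁ , ↭-sym ed))
locate {S = sb ∣ sg ⇒ sd} {C = cb ∣ cg ⇒ cd} {p = succ} (eb , eg , ed) with ↭-∷-++-split sd cd ed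
... | inj₁ (sd′ , es , e₁) = inj₁ ((sb ∣ sg ⇒ sd′) , (↭-refl , ↭-refl , es) , (↭-sym eb , ↭-sym eg , e₁))
... | inj₂ (cd′ , ec , e₁) = inj₂ ((cb ∣ cg ⇒ cd′) , (↭-refl , ↭-refl , ec) , (↭-sym eb , ↭-sym eg , e₁))

Bounded : Seq → ℕ → Set
Bounded S k = Σ[ d ∈ Proof S ] height d ≤ k

Proof-resp : S ≈S T → (d : Proof S) → Σ[ d′ ∈ Proof T ] height d′ ≡ height d
Proof-resp e (ax B G Z n x) = ax B G Z n (≈S-trans (≈S-sym e) x) , refl
Proof-resp e (ax⊥ B G Z x) = ax⊥ B G Z (≈S-trans (≈S-sym e) x) , refl
Proof-resp e (∧l B G Z a b x d) = ∧l B G Z a b (≈S-trans (≈S-sym e) x) d , refl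
Proof-resp e (∨r B G Z a b x d) = ∨r B G Z a b (≈S-trans (≈S-sym e) x) d , refl
Proof-resp e (¬r B G Z a x d) = ¬r B G Z a (≈S-trans (≈S-sym e) x) d , refl
Proof-resp e (¬l B G Z a x d) = ¬l B G Z a (≈S-trans (≈S-sym e) x) d , refl
Proof-resp e (∧r B G Z a b x d₁ d₂) = ∧r B G Z a b (≈S-trans (≈S-sym e) x) d₁ d₂ , refl
Proof-resp e (∨l B G Z a b x d₁ d₂) = ∨l B G Z a b (≈S-trans (≈S-sym e) x) d₁ d₂ , refl
Proof-resp e (□T B G Z a x d) = □T B G Z a (≈S-trans (≈S-sym e) x) d , refl
Proof-resp e (grz1 Γ Π Δ a x vs vbs D∈ d) = grz1 Γ Π Δ a (≈S-trans (≈S-sym e) x) vs vbs D∈ d , refl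
Proof-resp e (grz2 Γ Π Δ a x vs vbs D∉ d) = grz2 Γ Π Δ a (≈S-trans (≈S-sym e) x) vs vbs D∉ d , refl

bounded-resp : S ≈S T → Bounded S k → Bounded T k
bounded-resp e (d , h) with d′ , eq ← Proof-resp e d = d′ , ≤-trans (≤-reflexive eq) h

weaken : ∀ {k k′} → k ≤ k′ → Bounded S k → Bounded S k′
weaken k≤k′ (d , h) = d , ≤-trans h k≤k′

height-pos : (d : Proof S) → 1 ≤ height d
height-pos (ax _ _ _ _ _) = s≤s z≤n
height-pos (ax⊥ _ _ _ _) = s≤s z≤n
height-pos (∧l _ _ _ _ _ _ _) = s≤s z≤n
height-pos (∨r _ _ _ _ _ _ _) = s≤s z≤n
height-pos (¬r _ _ _ _ _ _) = s≤s z≤n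
height-pos (¬l _ _ _ _ _ _) = s≤s z≤n
height-pos (∧r _ _ _ _ _ _ _ _) = s≤s z≤n
height-pos (∨l _ _ _ _ _ _ _ _) = s≤s z≤n
height-pos (□T _ _ _ _ _ _) = s≤s z≤n
height-pos (grz1 _ _ _ _ _ _ _ _ _) = s≤s z≤n
height-pos (grz2 _ _ _ _ _ _ _ _ _) = s≤s z≤n

data Atom : Fm → Set where
  var-atom : ∀ n → Atom (var n)
  ⊥-atom   : Atom ⊥'

identity-proof : ∀ n → var n ∈ Seq.ante S → var n ∈ Seq.succ S → Bounded S 1
identity-proof {S = B ∣ G ⇒ Z} n l r with G′ , G↭ ← ∈⇒↭∷ l | Z′ , Z↭ ← ∈⇒↭∷ r =
  ax B G′ Z′ n (↭-refl , G↭ , Z↭) , ≤-refl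

absurdity-proof : ⊥' ∈ Seq.ante S → Bounded S 1
absurdity-proof {S = B ∣ G ⇒ Z} l with G′ , G↭ ← ∈⇒↭∷ l =
  ax⊥ B G′ Z (↭-refl , G↭ , ↭-refl) , ≤-refl

-- Rule p f ps: the rule concluding [ f ]at p ⊕ C from the premises P ⊕ C, P ∈ ps.
data Rule : Place → Fm → List Seq → Set where
  ∧l : ∀ {a b} → Rule ante (a ∧' b) (((a ∷ b ∷ []) at ante) ∷ [])
  ∨l : ∀ {a b} → Rule ante (a ∨' b) ([ a ]at ante ∷ [ b ]at ante ∷ [])
  ¬l : ∀ {a} → Rule ante (¬' a) ([ a ]at succ ∷ [])
  □T : ∀ {a} → Rule ante (□ a) ((a ∷ [] ∣ a ∷ [] ⇒ []) ∷ [])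
  ∧r : ∀ {a b} → Rule succ (a ∧' b) ([ a ]at succ ∷ [ b ]at succ ∷ [])
  ∨r : ∀ {a b} → Rule succ (a ∨' b) (((a ∷ b ∷ []) at succ) ∷ [])
  ¬r : ∀ {a} → Rule succ (¬' a) ([ a ]at ante ∷ [])

private
  variable
    p : Place
    ps qs : List Seq

rule-proof : Rule p f ps → S ≈S [ f ]at p ⊕ C → All (λ P → Bounded (P ⊕ C) k) ps → Bounded S (suc k)
rule-proof {C = B ∣ G ⇒ Z} ∧l e ((d , h) ∷ []) = ∧l B G Z _ _ e d , s≤s h
rule-proof {C = B ∣ G ⇒ Z} ∨l e ((d₁ , h₁) ∷ (d₂ , h₂) ∷ []) =
  ∨l B G Z _ _ e d₁ d₂ , s≤s (⊔-lub h₁ h₂)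
rule-proof {C = B ∣ G ⇒ Z} ¬l e ((d , h) ∷ []) = ¬l B G Z _ e d , s≤s h
rule-proof {C = B ∣ G ⇒ Z} □T e ((d , h) ∷ []) = □T B G Z _ e d , s≤s h
rule-proof {C = B ∣ G ⇒ Z} ∧r e ((d₁ , h₁) ∷ (d₂ , h₂) ∷ []) =
  ∧r B G Z _ _ e d₁ d₂ , s≤s (⊔-lub h₁ h₂)
rule-proof {C = B ∣ G ⇒ Z} ∨r e ((d , h) ∷ []) = ∨r B G Z _ _ e d , s≤s h
rule-proof {C = B ∣ G ⇒ Z} ¬r e ((d , h) ∷ []) = ¬r B G Z _ e d , s≤s h

rule-unique : Rule p f ps → Rule p f qs → ps ≡ qs
rule-unique ∧l ∧l = refl
rule-unique ∨l ∨l = refl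
rule-unique ¬l ¬l = refl
rule-unique □T □T = refl
rule-unique ∧r ∧r = refl
rule-unique ∨r ∨r = refl
rule-unique ¬r ¬r = refl

principal-not-atom : Atom f → ¬ Rule p f ps
principal-not-atom (var-atom n) ()
principal-not-atom ⊥-atom ()

VarOrBox : Fm → Set
VarOrBox f = IsVar f ⊎ IsBox f

data GrzPremise (Γ : List Fm) (a : Fm) (k : ℕ) : Set where
  grz₁ : (a →' □ a) ∈ Γ → Bounded (Γ ∣ [] ⇒ a ∷ []) k → GrzPremise Γ a k
  grz₂ : ¬ ((a →' □ a) ∈ Γ) → Bounded ((a →' □ a) ∷ Γ ∣ Γ ⇒ a ∷ []) k → GrzPremise Γ a k

record GrzConclusion (a : Fm) (S : Seq) : Set where
  field
    ante-vars   : All IsVar (Seq.ante S)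
    goal        : □ a ∈ Seq.succ S
    succ-varbox : All VarOrBox (Seq.succ S)
open GrzConclusion

grz-conclusion : ∀ {Π Δ} → Seq.ante S ↭ Π → Seq.succ S ↭ □ a ∷ Δ →
                 All IsVar Π → All VarOrBox Δ → GrzConclusion a S
grz-conclusion eg ez vs vbs = record
  { ante-vars   = All-resp-↭ (↭-sym eg) vs
  ; goal        = ∈-resp-↭ (↭-sym ez) (here refl)
  ; succ-varbox = All-resp-↭ (↭-sym ez) (inj₂ (_ , refl) ∷ vbs)
  }

grz-premise-resp : ∀ {Γ Γ′} → Γ ↭ Γ′ → GrzPremise Γ a k → GrzPremise Γ′ a k
grz-premise-resp e (grz₁ D∈ d) = grz₁ (∈-resp-↭ e D∈) (bounded-resp (e , ↭-refl , ↭-refl) d)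
grz-premise-resp e (grz₂ D∉ d) =
  grz₂ (D∉ ∘ ∈-resp-↭ (↭-sym e)) (bounded-resp (↭-prep _ e , e , ↭-refl) d)

grz-succ-split : GrzConclusion a S → ∃[ Δ ] (Seq.succ S ↭ □ a ∷ Δ) × All VarOrBox Δ
grz-succ-split concl with Δ , Z↭ ← ∈⇒↭∷ (goal concl) =
  Δ , Z↭ , All.tail (All-resp-↭ Z↭ (succ-varbox concl))

grz-proof : GrzPremise (Seq.boxed S) a k → GrzConclusion a S → Bounded S (suc k)
grz-proof {S = B ∣ G ⇒ Z} {a} (grz₁ D∈ (d , h)) concl with Δ , Z↭ , vbs ← grz-succ-split concl =
  grz1 B G Δ a (↭-refl , ↭-refl , Z↭) (ante-vars concl) vbs D∈ d , s≤s h
grz-proof {S = B ∣ G ⇒ Z} {a} (grz₂ D∉ (d , h)) concl with Δ , Z↭ , vbs ← grz-succ-split concl =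
  grz2 B G Δ a (↭-refl , ↭-refl , Z↭) (ante-vars concl) vbs D∉ d , s≤s h

rule-not-grz : Rule p f ps → ¬ GrzConclusion a ([ f ]at p ⊕ C)
rule-not-grz {p = ante} r concl with n , refl ← All.head (ante-vars concl) = principal-not-atom (var-atom n) r
rule-not-grz {p = succ} r concl with All.head (succ-varbox concl)
... | inj₁ (n , refl) = principal-not-atom (var-atom n) r
... | inj₂ (b , refl) with () ← r

data LastStep (S : Seq) (k : ℕ) : Set where
  identity  : ∀ n → var n ∈ Seq.ante S → var n ∈ Seq.succ S → LastStep S k
  absurdity : ⊥' ∈ Seq.ante S → LastStep S k
  rule      : Rule p f ps → ∀ C → S ≈S [ f ]at p ⊕ C → All (λ P → Bounded (P ⊕ C) k) ps → LastStep S k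
  grz       : GrzPremise (Seq.boxed S) a k → GrzConclusion a S → LastStep S k

last-step : Bounded S (suc k) → LastStep S k
last-step (ax _ _ _ n (_ , eg , ez) , _) =
  identity n (∈-resp-↭ (↭-sym eg) (here refl)) (∈-resp-↭ (↭-sym ez) (here refl))
last-step (ax⊥ _ _ _ (_ , eg , _) , _) = absurdity (∈-resp-↭ (↭-sym eg) (here refl))
last-step (∧l B G Z _ _ e d , h) = rule ∧l (B ∣ G ⇒ Z) e ((d , s≤s⁻¹ h) ∷ [])
last-step (∨r B G Z _ _ e d , h) = rule ∨r (B ∣ G ⇒ Z) e ((d , s≤s⁻¹ h) ∷ [])
last-step (¬r B G Z _ e d , h) = rule ¬r (B ∣ G ⇒ Z) e ((d , s≤s⁻¹ h) ∷ [])
last-step (¬l B G Z _ e d , h) = rule ¬l (B ∣ G ⇒ Z) e ((d , s≤s⁻¹ h) ∷ [])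
last-step (□T B G Z _ e d , h) = rule □T (B ∣ G ⇒ Z) e ((d , s≤s⁻¹ h) ∷ [])
last-step (∧r B G Z _ _ e d₁ d₂ , h) =
  rule ∧r (B ∣ G ⇒ Z) e ((d₁ , m⊔n≤o⇒m≤o _ _ (s≤s⁻¹ h)) ∷ (d₂ , m⊔n≤o⇒n≤o _ _ (s≤s⁻¹ h)) ∷ [])
last-step (∨l B G Z _ _ e d₁ d₂ , h) =
  rule ∨l (B ∣ G ⇒ Z) e ((d₁ , m⊔n≤o⇒m≤o _ _ (s≤s⁻¹ h)) ∷ (d₂ , m⊔n≤o⇒n≤o _ _ (s≤s⁻¹ h)) ∷ [])
last-step (grz1 _ _ _ _ (eb , eg , ez) vs vbs D∈ d , h) =
  grz (grz-premise-resp (↭-sym eb) (grz₁ D∈ (d , s≤s⁻¹ h))) (grz-conclusion eg ez vs vbs)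
last-step (grz2 _ _ _ _ (eb , eg , ez) vs vbs D∉ d , h) =
  grz (grz-premise-resp (↭-sym eb) (grz₂ D∉ (d , s≤s⁻¹ h))) (grz-conclusion eg ez vs vbs)

Admissible≤ : ℕ → Seq → Seq → Set
Admissible≤ k S T = ∀ C → Bounded (S ⊕ C) k → Bounded (T ⊕ C) k

admissible≤-0 : Admissible≤ 0 S T
admissible≤-0 C (d , h) with () ← ≤-trans (height-pos d) h

hp-admissible : (∀ k → Admissible≤ k S T) → ∀ C → HPAdmissible (S ⊕ C) (T ⊕ C)
hp-admissible adm C d = adm (height d) C (d , ≤-refl)

infix 4 _⊆-atoms_

_⊆-atoms_ : Seq → Seq → Set
S ⊆-atoms T = ∀ {x} → Atom x → (x ∈ Seq.ante S → x ∈ Seq.ante T) × (x ∈ Seq.succ S → x ∈ Seq.succ T)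

PrincipalCase : ℕ → Seq → Seq → Set
PrincipalCase k S T = ∀ {p f ps} → Rule p f ps → ∀ rest C → S ≈S [ f ]at p ⊕ rest →
                      All (λ P → Bounded (P ⊕ (rest ⊕ C)) k) ps → Bounded (T ⊕ C) (suc k)

GrzCase : ℕ → Seq → Seq → Set
GrzCase k S T = ∀ {a} C → GrzPremise (Seq.boxed (S ⊕ C)) a k → GrzConclusion a (S ⊕ C) →
                Bounded (T ⊕ C) (suc k)

record StepCases (k : ℕ) (S T : Seq) : Set where
  field
    atoms     : S ⊆-atoms T
    principal : PrincipalCase k S T
    grz-case  : GrzCase k S T

admissible-step : Admissible≤ k S T → StepCases k S T → Admissible≤ (suc k) S T
admissible-step {k} {S} {T} ih cases C d = from (last-step d)
  where
  open StepCases cases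
  from : LastStep (S ⊕ C) k → Bounded (T ⊕ C) (suc k)
  from (identity n l r) = weaken (s≤s z≤n) (identity-proof n
    (∈-++-monoˡ (Seq.ante S) (proj₁ (atoms (var-atom n))) l)
    (∈-++-monoˡ (Seq.succ S) (proj₂ (atoms (var-atom n))) r))
  from (absurdity l) = weaken (s≤s z≤n) (absurdity-proof (∈-++-monoˡ (Seq.ante S) (proj₁ (atoms ⊥-atom)) l))
  from (rule {p} {f} r C₁ e prems) with locate {S = S} {C = C} {f = f} {p = p} {C₁ = C₁} e
  ... | inj₁ (rest , S≈ , C₁≈) =
    principal r rest C S≈ (All.map (λ {P} → bounded-resp (⊕-congˡ P C₁≈)) prems)
  ... | inj₂ (C₂ , C≈ , C₁≈) =
    rule-proof r (≈S-trans (⊕-congˡ T C≈) (⊕-swap T ([ f ]at p) C₂)) (All.map commute prems)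
    where
    commute : ∀ {P} → Bounded (P ⊕ C₁) k → Bounded (P ⊕ (T ⊕ C₂)) k
    commute {P} d = bounded-resp (⊕-swap T P C₂)
      (ih (P ⊕ C₂) (bounded-resp (≈S-trans (⊕-congˡ P C₁≈) (⊕-swap P S C₂)) d))
  from (grz prem concl) = grz-case C prem concl

-- Inversion

principal-⊆-atoms : Rule p f ps → [ f ]at p ⊆-atoms T
principal-⊆-atoms {p = ante} r a = (λ { (here refl) → ⊥-elim (principal-not-atom a r) }) , λ ()
principal-⊆-atoms {p = succ} r a = (λ ()) , λ { (here refl) → ⊥-elim (principal-not-atom a r) }

invert : Rule p f ps → ∀ {P} → P ∈ ps → ∀ k → Admissible≤ k ([ f ]at p) P
invert r P∈ zero = admissible≤-0
invert {p} {f} {ps} r {P} P∈ (suc k) = admissible-step (invert r P∈ k) record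
  { atoms     = principal-⊆-atoms {T = P} r
  ; principal = principal
  ; grz-case  = λ _ _ concl → ⊥-elim (rule-not-grz r concl)
  }
  where
  principal : PrincipalCase k ([ f ]at p) P
  principal {q} {g} r′ rest C e prems
    with refl , refl , rest≈ ← at-replicate-inv {α = f} {g} {p} {q} {rest} 0 e
                                  with refl ← rule-unique r r′ =
    weaken (n≤1+n k) (bounded-resp (⊕-congˡ P (⊕-congʳ C (≈S-trans rest≈ ([]-at p)))) (All.lookup prems P∈))

-- Contraction

Contraction : ℕ → Set
Contraction k = ∀ p α → Admissible≤ k ((α ∷ α ∷ []) at p) ([ α ]at p)

contract-copies : Contraction k → ∀ P → Admissible≤ k (P ⊕ P) P
contract-copies {k} contract₁ (bs ∣ gs ⇒ ds) = copies bs gs ds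
  where
  contract-cons : ∀ p x Q → Admissible≤ k (Q ⊕ Q) Q →
                  Admissible≤ k (([ x ]at p ⊕ Q) ⊕ ([ x ]at p ⊕ Q)) ([ x ]at p ⊕ Q)
  contract-cons p x Q contractQ C d =
    bounded-resp regroup (contractQ (X ⊕ C)
      (bounded-resp shuffle (contract₁ p x ((Q ⊕ Q) ⊕ C) (bounded-resp pair-up d))))
    where
    X = [ x ]at p
    pair-up : ((X ⊕ Q) ⊕ (X ⊕ Q)) ⊕ C ≈S (x ∷ x ∷ []) at p ⊕ ((Q ⊕ Q) ⊕ C)
    pair-up = ≈S-trans
      (solve 3 (λ y q c → ((y ⊕′ q) ⊕′ (y ⊕′ q)) ⊕′ c ⊜ (y ⊕′ y) ⊕′ ((q ⊕′ q) ⊕′ c)) ≈S-refl X Q C)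
      (⊕-congʳ ((Q ⊕ Q) ⊕ C) (≈S-sym (pair-at p)))
    shuffle : X ⊕ ((Q ⊕ Q) ⊕ C) ≈S (Q ⊕ Q) ⊕ (X ⊕ C)
    shuffle = solve 3 (λ y q c → y ⊕′ ((q ⊕′ q) ⊕′ c) ⊜ (q ⊕′ q) ⊕′ (y ⊕′ c)) ≈S-refl X Q C
    regroup : Q ⊕ (X ⊕ C) ≈S (X ⊕ Q) ⊕ C
    regroup = solve 3 (λ y q c → q ⊕′ (y ⊕′ c) ⊜ (y ⊕′ q) ⊕′ c) ≈S-refl X Q C
  copies : ∀ bs gs ds → Admissible≤ k ((bs ∣ gs ⇒ ds) ⊕ (bs ∣ gs ⇒ ds)) (bs ∣ gs ⇒ ds)
  copies [] [] [] C d = d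
  copies (x ∷ bs) gs ds = contract-cons boxed x (bs ∣ gs ⇒ ds) (copies bs gs ds)
  copies [] (x ∷ gs) ds = contract-cons ante x ([] ∣ gs ⇒ ds) (copies [] gs ds)
  copies [] [] (x ∷ ds) = contract-cons succ x ([] ∣ [] ⇒ ds) (copies [] [] ds)

pair-⊆-atoms : ∀ p → (α ∷ α ∷ []) at p ⊆-atoms [ α ]at p
pair-⊆-atoms boxed _ = (λ ()) , (λ ())
pair-⊆-atoms ante  _ = ∈-dedup , (λ ())
pair-⊆-atoms succ  _ = (λ ()) , ∈-dedup

contraction-cases : Contraction k → ∀ p α → StepCases k ((α ∷ α ∷ []) at p) ([ α ]at p)
contraction-cases {k} contract₁ p α = record
  { atoms     = pair-⊆-atoms p
  ; principal = principal
  ; grz-case  = grz-case p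
  }
  where
  principal : PrincipalCase k ((α ∷ α ∷ []) at p) ([ α ]at p)
  principal {q} {g} {ps} r rest C e prems
    with refl , refl , rest≈ ← at-replicate-inv {α = α} {g} {p} {q} {rest} 1 e =
    rule-proof r ≈S-refl (All.tabulate (λ P∈ → contract-copies contract₁ _ C (duplicated P∈)))
    where
    duplicated : ∀ {P} → P ∈ ps → Bounded ((P ⊕ P) ⊕ C) k
    duplicated {P} P∈ = bounded-resp (≈S-sym (⊕-assoc P P C))
      (invert r P∈ k (P ⊕ C)
        (bounded-resp (≈S-trans (⊕-congˡ P (⊕-congʳ C rest≈)) (⊕-swap P ([ α ]at p) C))
          (All.lookup prems P∈)))

  contract-grz-premise : ∀ {B a} → GrzPremise (α ∷ α ∷ B) a k → GrzPremise (α ∷ B) a k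
  contract-grz-premise {B} {a} (grz₁ D∈ d) = grz₁ (∈-dedup D∈) (contract₁ boxed α (B ∣ [] ⇒ a ∷ []) d)
  contract-grz-premise {B} {a} (grz₂ D∉ d) =
    grz₂ (D∉ ∘ there)
      (bounded-resp (⊕-swap P X C′) (contract-copies contract₁ P (X ⊕ C′) (bounded-resp rearrange d)))
    where
    P = α ∷ [] ∣ α ∷ [] ⇒ []
    X = [ a →' □ a ]at boxed
    C′ = B ∣ B ⇒ a ∷ []
    rearrange : X ⊕ (P ⊕ (P ⊕ C′)) ≈S (P ⊕ P) ⊕ (X ⊕ C′)
    rearrange = solve 3 (λ x q c → x ⊕′ (q ⊕′ (q ⊕′ c)) ⊜ (q ⊕′ q) ⊕′ (x ⊕′ c)) ≈S-refl X P C′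

  grz-case : ∀ p → GrzCase k ((α ∷ α ∷ []) at p) ([ α ]at p)
  grz-case boxed C prem concl = grz-proof (contract-grz-premise prem) record
    { ante-vars = ante-vars concl ; goal = goal concl ; succ-varbox = succ-varbox concl }
  grz-case ante C prem concl = grz-proof prem record
    { ante-vars = All.tail (ante-vars concl) ; goal = goal concl ; succ-varbox = succ-varbox concl }
  grz-case succ C prem concl = grz-proof prem record
    { ante-vars = ante-vars concl ; goal = ∈-dedup (goal concl) ; succ-varbox = All.tail (succ-varbox concl) }

contract : ∀ k → Contraction k
contract zero    p α = admissible≤-0
contract (suc k) p α = admissible-step (contract k p α) (contraction-cases (contract k) p α)

lemma2p9 : (∀ Σ Γ Δ α → HPAdmissible (Σ ∣ α ∷ α ∷ Γ ⇒ Δ) (Σ ∣ α ∷ Γ ⇒ Δ))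
         × (∀ Σ Γ Δ α → HPAdmissible (Σ ∣ Γ ⇒ α ∷ α ∷ Δ) (Σ ∣ Γ ⇒ α ∷ Δ))
         × (∀ Σ Γ Δ α → HPAdmissible (α ∷ α ∷ Σ ∣ Γ ⇒ Δ) (α ∷ Σ ∣ Γ ⇒ Δ))
lemma2p9 = (λ Σ Γ Δ α → hp-admissible (λ k → contract k ante α) (Σ ∣ Γ ⇒ Δ))
         , (λ Σ Γ Δ α → hp-admissible (λ k → contract k succ α) (Σ ∣ Γ ⇒ Δ))
         , (λ Σ Γ Δ α → hp-admissible (λ k → contract k boxed α) (Σ ∣ Γ ⇒ Δ))
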